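{- For every simple substitution $\theta$ and every $n\in\mathbb N$, we have $\theta(n)=(\upsilon^{ -1}(\theta))(n)$.
   Context: Fix a signature $\Sigma$, hole constants $\square_1,\square_2,\dots$ and an infinite countable set $X$ of variables, pairwise disjoint. $T(\Sigma,X)$ is the set of terms, $S(\Sigma,X)$ the set of substitutions; composition $x(\sigma\theta)=(x\sigma)\theta$, $\emptyset$ the identity, $\sigma^0=\emptyset$, $\sigma^{n+1}=\sigma^n\sigma$. A 1-context is a term over $\Sigma\cup\{\square_1,\square_2,\dots\}$ and $X$ containing $\square_1$ and no other hole; $c(s)$ replaces every $\square_1$ by $s$; $c^0=\square_1$, $c^{n+1}=c(c^n)$; $\chi^{(1)}$ is the set of 1-contexts without variables. $\Upsilon$ is a set of new unary symbols $c^{a,b}$ ($c\in\chi^{(1)}$, $a,b\in\mathbb N$). For $u\in T(\Sigma\cup\Upsilon,X)$, $u(n)\in T(\Sigma,X)$ is obtained by replacing every symbol $c^{a,b}$ by the nesting $c^{a\times n+b}$; for $\theta\in S(\Sigma\cup\Upsilon,X)$, $\theta(n)\in S(\Sigma,X)$ is defined by $(\theta(n))(x)=(\theta(x))(n)$. $u\sim v$ iff $u(n)=v(n)$ for all $n$; $[u]$ is the $\sim$-class of $u$. A pattern substitution is a pair $(\sigma,\mu)\in S(\Sigma,X)^2$, with $(\sigma,\mu)(n)=\sigma^n\mu$. A substitution $\theta\in S(\Sigma\cup\Upsilon,X)$ is simple if for every $x\in X$, $\theta(x)\in[c^{a,b}(t)]$ for some $c\in\chi^{(1)}$, $a,b\in\mathbb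 N$ and $t\in T(\Sigma,X)$; then $\upsilon^{ -1}(\theta)$ is the pattern substitution $(\sigma,\mu)$ such that for all $x\in X$, if $\theta(x)\in[c^{a,b}(t)]$ then $\sigma(x)=c^a(x)$ and $\mu(x)=c^b(t)$. -}

module Defs where

open import Data.Nat using (ℕ; zero; suc; _+_; _*_)
open import Data.Fin using (Fin)
open import Data.Vec using (Vec; []; _∷_; lookup)
open import Data.Sum using (_⊎_; inj₁; inj₂; [_,_])
open import Data.Unit using (⊤; tt)
open import Data.Empty using (⊥)
open import Data.Product using (Σ; _×_; _,_; proj₁)
open import Relation.Binary.PropositionalEquality using (_≡_)

record Signature : Set₁ where
  field
    Sym   : Set
    arity : Sym → ℕ
open Signature public

data Term (S : Signature) (V : Set) : Set where
  var : V → Term S V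
  fun : (f : Sym S) → Vec (Term S V) (arity S f) → Term S V

-- The variable set X is ℕ (infinite countable).
-- T(S,X)
T : Signature → Set
T S = Term S ℕ

Subst : Signature → Set
Subst S = ℕ → T S

module _ {S : Signature} where

  mutual
    _⟨_⟩ : T S → Subst S → T S
    var x    ⟨ σ ⟩ = σ x
    fun f ts ⟨ σ ⟩ = fun f (ts ⟨ σ ⟩*)

    _⟨_⟩* : ∀ {k} → Vec (T S) k → Subst S → Vec (T S) k
    []       ⟨ σ ⟩* = []
    (t ∷ ts) ⟨ σ ⟩* = (t ⟨ σ ⟩) ∷ (ts ⟨ σ ⟩*)

  ∅ : Subst S
  ∅ = var

  _⨾_ : Subst S → Subst S → Subst S
  (σ ⨾ θ) x = (σ x) ⟨ θ ⟩

  _^ˢ_ : Subst S → ℕ → Subst S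
  σ ^ˢ zero  = ∅
  σ ^ˢ suc n = (σ ^ˢ n) ⨾ σ

-- Signature extended with the hole constant □₁.
-- (A 1-context contains only the hole □₁, so the other holes are never needed.)
_⊡ : Signature → Signature
S ⊡ = record { Sym = Sym S ⊎ ⊤ ; arity = [ arity S , (λ _ → 0) ] }

module _ {S : Signature} where

  □₁ : ∀ {V} → Term (S ⊡) V
  □₁ = fun (inj₂ tt) []

  data HasHole {V : Set} : Term (S ⊡) V → Set where
    here  : HasHole □₁
    there : ∀ {f ts} (i : Fin (arity (S ⊡) f)) → HasHole (lookup ts i) → HasHole (fun f ts)

χ¹ : Signature → Set
χ¹ S = Σ (Term (S ⊡) ⊥) (HasHole {S})

module _ {S : Signature} where

  mutual
    plug : Term (S ⊡) ⊥ → T S → T S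
    plug (var ())
    plug (fun (inj₁ f) cs) s = fun f (plug* cs s)
    plug (fun (inj₂ tt) []) s = s

    plug* : ∀ {k} → Vec (Term (S ⊡) ⊥) k → T S → Vec (T S) k
    plug* [] s       = []
    plug* (c ∷ cs) s = plug c s ∷ plug* cs s

  _^ᶜ_[_] : χ¹ S → ℕ → T S → T S
  c ^ᶜ zero  [ s ] = s
  c ^ᶜ suc k [ s ] = plug (proj₁ c) (c ^ᶜ k [ s ])

_∪Υ : Signature → Signature
S ∪Υ = record { Sym = Sym S ⊎ (χ¹ S × ℕ × ℕ) ; arity = [ arity S , (λ _ → 1) ] }

module _ {S : Signature} where

  mutual
    _⟪_⟫ : T (S ∪Υ) → ℕ → T S
    var x ⟪ n ⟫ = var x
    fun (inj₁ f) us ⟪ n ⟫ = fun f (us ⟪ n ⟫*)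
    fun (inj₂ (c , a , b)) (u ∷ []) ⟪ n ⟫ = c ^ᶜ (a * n + b) [ u ⟪ n ⟫ ]

    _⟪_⟫* : ∀ {k} → Vec (T (S ∪Υ)) k → ℕ → Vec (T S) k
    [] ⟪ n ⟫*       = []
    (u ∷ us) ⟪ n ⟫* = (u ⟪ n ⟫) ∷ (us ⟪ n ⟫*)

  _⟪_⟫ˢ : Subst (S ∪Υ) → ℕ → Subst S
  (θ ⟪ n ⟫ˢ) x = (θ x) ⟪ n ⟫

  _∼_ : T (S ∪Υ) → T (S ∪Υ) → Set
  u ∼ v = ∀ n → u ⟪ n ⟫ ≡ v ⟪ n ⟫

  mutual
    embed : T S → T (S ∪Υ)
    embed (var x)    = var x
    embed (fun f ts) = fun (inj₁ f) (embed* ts)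

    embed* : ∀ {k} → Vec (T S) k → Vec (T (S ∪Υ)) k
    embed* []       = []
    embed* (t ∷ ts) = embed t ∷ embed* ts

  cab : χ¹ S → ℕ → ℕ → T S → T (S ∪Υ)
  cab c a b t = fun (inj₂ (c , a , b)) (embed t ∷ [])

  -- θ is simple: for every x, θ(x) ∈ [c^{a,b}(t)] for some c, a, b, t
  -- (constructively: a choice of such c, a, b, t for each x)
  Simple : Subst (S ∪Υ) → Set
  Simple θ = ∀ x → Σ (χ¹ S) λ c → Σ ℕ λ a → Σ ℕ λ b → Σ (T S) λ t → θ x ∼ cab c a b t

  PatternSubst : Set
  PatternSubst = Subst S × Subst S

  _⟪_⟫ᵖ : PatternSubst → ℕ → Subst S
  (σ , μ) ⟪ n ⟫ᵖ = (σ ^ˢ n) ⨾ μ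

  υ⁻¹ : (θ : Subst (S ∪Υ)) → Simple θ → PatternSubst
  υ⁻¹ θ w = (λ x → σx (w x)) , (λ x → μx (w x))
    where
      σx : ∀ {x} → Σ (χ¹ S) (λ c → Σ ℕ λ a → Σ ℕ λ b → Σ (T S) λ t → θ x ∼ cab c a b t) → T S
      σx {x} (c , a , b , t , _) = c ^ᶜ a [ var x ]
      μx : ∀ {x} → Σ (χ¹ S) (λ c → Σ ℕ λ a → Σ ℕ λ b → Σ (T S) λ t → θ x ∼ cab c a b t) → T S
      μx (c , a , b , t , _) = c ^ᶜ b [ t ]

module Submission where

-- A variable-free context commutes with substitution, so if σ(x) = cᵃ(x) then
-- σⁿ(x) = cᵃⁿ(x), and applying μ with μ(x) = cᵇ(t) yields cᵃⁿ⁺ᵇ(t); this is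
-- exactly the value at n of cᵃ'ᵇ(t), the representative of θ(x).

open import Defs
open import Data.Nat using (ℕ; zero; suc; _+_; _*_)
open import Data.Nat.Properties using (+-comm; *-comm)
open import Data.Vec using (Vec; []; _∷_)
open import Data.Sum using (inj₁; inj₂)
open import Data.Unit using (tt)
open import Data.Empty using (⊥)
open import Data.Product using (_,_; proj₁; proj₂)
open import Relation.Binary.PropositionalEquality using (_≡_; refl; sym; cong; cong₂; module ≡-Reasoning)
open ≡-Reasoning

module _ {S : Signature} where

  mutual
    plug-⟨⟩ : (c : Term (S ⊡) ⊥) (s : T S) (τ : Subst S) → plug c s ⟨ τ ⟩ ≡ plug c (s ⟨ τ ⟩)
    plug-⟨⟩ (var ())
    plug-⟨⟩ (fun (inj₁ f) cs) s τ = cong (fun f) (plug*-⟨⟩ cs s τ)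
    plug-⟨⟩ (fun (inj₂ tt) []) s τ = refl

    plug*-⟨⟩ : ∀ {k} (cs : Vec (Term (S ⊡) ⊥) k) (s : T S) (τ : Subst S) →
               plug* cs s ⟨ τ ⟩* ≡ plug* cs (s ⟨ τ ⟩)
    plug*-⟨⟩ [] s τ = refl
    plug*-⟨⟩ (c ∷ cs) s τ = cong₂ _∷_ (plug-⟨⟩ c s τ) (plug*-⟨⟩ cs s τ)

  ^ᶜ-⟨⟩ : (c : χ¹ S) (k : ℕ) (s : T S) (τ : Subst S) → c ^ᶜ k [ s ] ⟨ τ ⟩ ≡ c ^ᶜ k [ s ⟨ τ ⟩ ]
  ^ᶜ-⟨⟩ c zero s τ = refl
  ^ᶜ-⟨⟩ c (suc k) s τ = begin
    plug (proj₁ c) (c ^ᶜ k [ s ]) ⟨ τ ⟩   ≡⟨ plug-⟨⟩ (proj₁ c) _ τ ⟩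
    plug (proj₁ c) (c ^ᶜ k [ s ] ⟨ τ ⟩)   ≡⟨ cong (plug (proj₁ c)) (^ᶜ-⟨⟩ c k s τ) ⟩
    plug (proj₁ c) (c ^ᶜ k [ s ⟨ τ ⟩ ])   ∎

  ^ᶜ-+ : (c : χ¹ S) (k m : ℕ) (s : T S) → c ^ᶜ k [ c ^ᶜ m [ s ] ] ≡ c ^ᶜ (k + m) [ s ]
  ^ᶜ-+ c zero m s = refl
  ^ᶜ-+ c (suc k) m s = cong (plug (proj₁ c)) (^ᶜ-+ c k m s)

  mutual
    embed-⟪⟫ : (t : T S) (n : ℕ) → embed t ⟪ n ⟫ ≡ t
    embed-⟪⟫ (var x) n = refl
    embed-⟪⟫ (fun f ts) n = cong (fun f) (embed*-⟪⟫ ts n)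

    embed*-⟪⟫ : ∀ {k} (ts : Vec (T S) k) (n : ℕ) → embed* ts ⟪ n ⟫* ≡ ts
    embed*-⟪⟫ [] n = refl
    embed*-⟪⟫ (t ∷ ts) n = cong₂ _∷_ (embed-⟪⟫ t n) (embed*-⟪⟫ ts n)

  cab-⟪⟫ : (c : χ¹ S) (a b : ℕ) (t : T S) (n : ℕ) → cab c a b t ⟪ n ⟫ ≡ c ^ᶜ (a * n + b) [ t ]
  cab-⟪⟫ c a b t n = cong (c ^ᶜ (a * n + b) [_]) (embed-⟪⟫ t n)

  ^ˢ-^ᶜ : (σ : Subst S) (x : ℕ) (c : χ¹ S) (a : ℕ) → σ x ≡ c ^ᶜ a [ var x ] →
          (n : ℕ) → (σ ^ˢ n) x ≡ c ^ᶜ (n * a) [ var x ]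
  ^ˢ-^ᶜ σ x c a σx≡cᵃx zero = refl
  ^ˢ-^ᶜ σ x c a σx≡cᵃx (suc n) = begin
    (σ ^ˢ n) x ⟨ σ ⟩                   ≡⟨ cong (_⟨ σ ⟩) (^ˢ-^ᶜ σ x c a σx≡cᵃx n) ⟩
    c ^ᶜ (n * a) [ var x ] ⟨ σ ⟩       ≡⟨ ^ᶜ-⟨⟩ c (n * a) (var x) σ ⟩
    c ^ᶜ (n * a) [ σ x ]               ≡⟨ cong (c ^ᶜ (n * a) [_]) σx≡cᵃx ⟩
    c ^ᶜ (n * a) [ c ^ᶜ a [ var x ] ]  ≡⟨ ^ᶜ-+ c (n * a) a (var x) ⟩
    c ^ᶜ (n * a + a) [ var x ]         ≡⟨ cong (c ^ᶜ_[ var x ]) (+-comm (n * a) a) ⟩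
    c ^ᶜ (a + n * a) [ var x ]         ∎

  ⟪⟫ᵖ-^ᶜ : (σ μ : Subst S) (x : ℕ) (c : χ¹ S) (a b : ℕ) (t : T S) →
           σ x ≡ c ^ᶜ a [ var x ] → μ x ≡ c ^ᶜ b [ t ] →
           (n : ℕ) → ((σ , μ) ⟪ n ⟫ᵖ) x ≡ c ^ᶜ (a * n + b) [ t ]
  ⟪⟫ᵖ-^ᶜ σ μ x c a b t σx≡cᵃx μx≡cᵇt n = begin
    (σ ^ˢ n) x ⟨ μ ⟩               ≡⟨ cong (_⟨ μ ⟩) (^ˢ-^ᶜ σ x c a σx≡cᵃx n) ⟩
    c ^ᶜ (n * a) [ var x ] ⟨ μ ⟩   ≡⟨ ^ᶜ-⟨⟩ c (n * a) (var x) μ ⟩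
    c ^ᶜ (n * a) [ μ x ]           ≡⟨ cong (c ^ᶜ (n * a) [_]) μx≡cᵇt ⟩
    c ^ᶜ (n * a) [ c ^ᶜ b [ t ] ]  ≡⟨ ^ᶜ-+ c (n * a) b t ⟩
    c ^ᶜ (n * a + b) [ t ]         ≡⟨ cong (λ k → c ^ᶜ k + b [ t ]) (*-comm n a) ⟩
    c ^ᶜ (a * n + b) [ t ]         ∎

-- The components of υ⁻¹ θ w at x are definitionally cᵃ(x) and cᵇ(t), by η for Σ.
lemma4p9 : (S : Signature) (θ : Subst (S ∪Υ)) (w : Simple θ) (n : ℕ) (x : ℕ) →
    (θ ⟪ n ⟫ˢ) x ≡ (υ⁻¹ θ w ⟪ n ⟫ᵖ) x
lemma4p9 S θ w n x = begin
  θ x ⟪ n ⟫               ≡⟨ θx∼cᵃᵇt n ⟩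
  cab c a b t ⟪ n ⟫       ≡⟨ cab-⟪⟫ c a b t n ⟩
  c ^ᶜ (a * n + b) [ t ]  ≡⟨ sym (⟪⟫ᵖ-^ᶜ σ μ x c a b t refl refl n) ⟩
  ((σ , μ) ⟪ n ⟫ᵖ) x      ∎
  where
    σ = proj₁ (υ⁻¹ θ w)
    μ = proj₂ (υ⁻¹ θ w)
    c = proj₁ (w x)
    a = proj₁ (proj₂ (w x))
    b = proj₁ (proj₂ (proj₂ (w x)))
    t = proj₁ (proj₂ (proj₂ (proj₂ (w x))))
    θx∼cᵃᵇt = proj₂ (proj₂ (proj₂ (proj₂ (w x))))
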